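{- $\Omega\approx_{env}^p\mathcal{S}k.\Omega$, i.e., for every closed pure context $E$, $(\emptyset,\emptyset,\langle E[\Omega]\rangle)\approx_{env}^p(\emptyset,\emptyset,\langle E[\mathcal{S}k.\Omega]\rangle)$, where $\Omega=(\lambda x.x\,x)(\lambda x.x\,x)$.
   Context: Calculus $\lambda_S$: terms $t ::= v \mid t\,t \mid \mathcal{S}k.t \mid \langle t\rangle$, values $v ::= x \mid \lambda x.t$; pure contexts $E ::= \square \mid v\,E \mid E\,t$; evaluation contexts $F ::= \square \mid v\,F \mid F\,t \mid \langle F\rangle$. Reduction: $F[(\lambda x.t)\,v] \to F[t\{v/x\}]$; $F[\langle E[\mathcal{S}k.t]\rangle] \to F[\langle t\{\lambda x.\langle E[x]\rangle/k\}\rangle]$ ($x\notin\mathrm{fv}(E)$); $F[\langle v\rangle]\to F[v]$. Multi-hole contexts: $\mathbb{C} ::= \mathbb{V} \mid \mathbb{C}\,\mathbb{C} \mid \langle\mathbb{C}\rangle \mid \mathcal{S}k.\mathbb{C} \mid \blacksquare_j[\mathbb{C}]$; $\mathbb{V} ::= x \mid \lambda x.\mathbb{C} \mid \square_i$; $\mathbb{F} ::= \square \mid \mathbb{F}\,\mathbb{C} \mid \mathbb{V}\,\mathbb{F} \mid \langle\mathbb{F}\rangle \mid \blacksquare_j[\mathbb{F}]$. For a sequence $\Gamma$ of closed values and $\Phi$ of closed evaluation contexts, $\mathbb{C}[\Phi;\Gamma]$ replaces $\square_i$ by $\Gamma_i$ and $\blacksquare_j[\cdot]$ by plugging into $\Phi_j$;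 $\mathbb{F}[t;\Phi;\Gamma]$ additionally fills $\square$ with $t$; $\mathbb{F}[\Phi;\Gamma]$ leaves $\square$ open. Only closed multi-hole contexts are used; an evaluation context is delimited if of the form $\langle F'\rangle$. Pure terms $p ::= v\mid\langle t\rangle$. States: pure states $(\Phi,\Gamma,p)$ and environment states $(\Phi,\Gamma)$. LTS: if $p\to p'$ then $(\Phi,\Gamma,p)\xrightarrow{\tau}(\Phi,\Gamma,p')$; if $\Gamma_i=\lambda x.t$ and $\mathbb{F}[\Phi;\Gamma]$ is delimited then $(\Phi,\Gamma)\xrightarrow{\lambda,i,\mathbb{V},\mathbb{F}}(\Phi,\Gamma,\mathbb{F}[t\{\mathbb{V}[\Phi;\Gamma]/x\};\Phi;\Gamma])$; $(\Phi,\Gamma,v)\xrightarrow{\downarrow}(\Phi,(\Gamma,v))$; if $\mathbb{F}[\Phi;\Gamma]$ is delimited then $(\Phi,\Gamma)\xrightarrow{\square,j,\mathbb{V},\mathbb{F}}(\Phi,\Gamma,\mathbb{F}[\Phi_j[\mathbb{V}[\Phi;\Gamma]];\Phi;\Gamma])$; if $\Phi_j$ is pure then $(\Phi,\Gamma)\xrightarrow{pure,j}(\Phi,\Gamma)$; if $\Phi_j=F[\langle E\rangle]$ with $E$ pure then $(\Phi,\Gamma)\xrightarrow{split,j}((\Phi,F[\langle\square\rangle],\langle E\rangle),\Gamma)$. $\overset{\tau}{\Rightarrow}$ is the reflexive-transitive closure of $\xrightarrow{\tau}$, $\overset{\alpha}{\Rightarrow}=\overset{\tau}{\Rightarrow}\xrightarrow{\alpha}\overset{\tau}{\Rightarrow}$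 for $\alpha\ne\tau$. A pure environmental bisimulation is a relation $R$ on states such that $s\,R\,s'$ and $s\xrightarrow{\alpha}s_1$ imply $s'\overset{\alpha}{\Rightarrow}s_1'$ with $s_1\,R\,s_1'$ for some $s_1'$, and symmetrically; $\approx_{env}^p$ is the largest one. For arbitrary closed terms, $t_0\approx_{env}^p t_1$ iff for every closed pure context $E$, $(\emptyset,\emptyset,\langle E[t_0]\rangle)\approx_{env}^p(\emptyset,\emptyset,\langle E[t_1]\rangle)$. -}

module Defs where

open import Data.Nat using (ℕ; zero; suc)
open import Data.Fin using (Fin; zero; suc)
open import Data.Vec using (Vec; []; _∷_; lookup; _∷ʳ_)
open import Data.Product using (Σ; ∃; _×_; _,_)
open import Relation.Binary.PropositionalEquality using (_≡_)
open import Relation.Binary.Construct.Closure.ReflexiveTransitive using (Star)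

-- Syntax of λS (well-scoped de Bruijn terms; scope n = number of
-- free variables).  Values are a separate syntactic category.

mutual
  data Tm (n : ℕ) : Set where
    val : Val n → Tm n
    app : Tm n → Tm n → Tm n
    sft : Tm (suc n) → Tm n        -- S k. t   (k is variable 0)
    rst : Tm n → Tm n

  data Val (n : ℕ) : Set where
    var : Fin n → Val n
    lam : Tm (suc n) → Val n

Ren : ℕ → ℕ → Set
Ren n m = Fin n → Fin m

ext : ∀ {n m} → Ren n m → Ren (suc n) (suc m)
ext ρ zero = zero
ext ρ (suc i) = suc (ρ i)

mutual
  renT : ∀ {n m} → Ren n m → Tm n → Tm m
  renT ρ (val v) = val (renV ρ v)
  renT ρ (app t u) = app (renT ρ t) (renT ρ u)
  renT ρ (sft t) = sft (renT (ext ρ) t)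
  renT ρ (rst t) = rst (renT ρ t)

  renV : ∀ {n m} → Ren n m → Val n → Val m
  renV ρ (var i) = var (ρ i)
  renV ρ (lam t) = lam (renT (ext ρ) t)

Sub : ℕ → ℕ → Set
Sub n m = Fin n → Val m

exts : ∀ {n m} → Sub n m → Sub (suc n) (suc m)
exts σ zero = var zero
exts σ (suc i) = renV suc (σ i)

mutual
  subT : ∀ {n m} → Sub n m → Tm n → Tm m
  subT σ (val v) = val (subV σ v)
  subT σ (app t u) = app (subT σ t) (subT σ u)
  subT σ (sft t) = sft (subT (exts σ) t)
  subT σ (rst t) = rst (subT σ t)

  subV : ∀ {n m} → Sub n m → Val n → Val m
  subV σ (var i) = σ i
  subV σ (lam t) = lam (subT (exts σ) t)

sub0 : ∀ {n} → Val n → Sub (suc n) n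
sub0 v zero = v
sub0 v (suc i) = var i

_[_] : ∀ {n} → Tm (suc n) → Val n → Tm n
t [ v ] = subT (sub0 v) t

data PCtx (n : ℕ) : Set where
  hole : PCtx n
  appR : Val n → PCtx n → PCtx n
  appL : PCtx n → Tm n → PCtx n

data ECtx (n : ℕ) : Set where
  hole : ECtx n
  appR : Val n → ECtx n → ECtx n
  appL : ECtx n → Tm n → ECtx n
  rst  : ECtx n → ECtx n

plugE : ∀ {n} → PCtx n → Tm n → Tm n
plugE hole t = t
plugE (appR v E) t = app (val v) (plugE E t)
plugE (appL E u) t = app (plugE E t) u

plugF : ∀ {n} → ECtx n → Tm n → Tm n
plugF hole t = t
plugF (appR v F) t = app (val v) (plugF F t)
plugF (appL F u) t = app (plugF F t) u
plugF (rst F) t = rst (plugF F t)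

embE : ∀ {n} → PCtx n → ECtx n
embE hole = hole
embE (appR v E) = appR v (embE E)
embE (appL E u) = appL (embE E) u

composeF : ∀ {n} → ECtx n → ECtx n → ECtx n
composeF hole G = G
composeF (appR v F) G = appR v (composeF F G)
composeF (appL F u) G = appL (composeF F G) u
composeF (rst F) G = rst (composeF F G)

renE : ∀ {n m} → Ren n m → PCtx n → PCtx m
renE ρ hole = hole
renE ρ (appR v E) = appR (renV ρ v) (renE ρ E)
renE ρ (appL E u) = appL (renE ρ E) (renT ρ u)

renF : ∀ {n m} → Ren n m → ECtx n → ECtx m
renF ρ hole = hole
renF ρ (appR v F) = appR (renV ρ v) (renF ρ F)
renF ρ (appL F u) = appL (renF ρ F) (renT ρ u)
renF ρ (rst F) = rst (renF ρ F)

infix 4 _⟶_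
data _⟶_ {n : ℕ} : Tm n → Tm n → Set where
  βv    : ∀ (F : ECtx n) (t : Tm (suc n)) (v : Val n) →
          plugF F (app (val (lam t)) (val v)) ⟶ plugF F (t [ v ])
  shift : ∀ (F : ECtx n) (E : PCtx n) (t : Tm (suc n)) →
          plugF F (rst (plugE E (sft t)))
            ⟶ plugF F (rst (t [ lam (rst (plugE (renE suc E) (val (var zero)))) ]))
  reset : ∀ (F : ECtx n) (v : Val n) →
          plugF F (rst (val v)) ⟶ plugF F (val v)

-- Multi-hole contexts: scope n, g value holes □ᵢ, f context holes ■ⱼ

mutual
  data MC (n g f : ℕ) : Set where
    mval : MV n g f → MC n g f
    mapp : MC n g f → MC n g f → MC n g f
    mrst : MC n g f → MC n g f
    msft : MC (suc n) g f → MC n g f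
    mbox : Fin f → MC n g f → MC n g f

  data MV (n g f : ℕ) : Set where
    mvar  : Fin n → MV n g f
    mlam  : MC (suc n) g f → MV n g f
    mhole : Fin g → MV n g f

data MF (g f : ℕ) : Set where
  fhole : MF g f
  fappL : MF g f → MC 0 g f → MF g f
  fappR : MV 0 g f → MF g f → MF g f
  frst  : MF g f → MF g f
  fbox  : Fin f → MF g f → MF g f

closedRen : ∀ {n} → Ren 0 n
closedRen ()

mutual
  fillC : ∀ {n g f} → Vec (ECtx 0) f → Vec (Val 0) g → MC n g f → Tm n
  fillC Φ Γ (mval V) = val (fillV Φ Γ V)
  fillC Φ Γ (mapp C D) = app (fillC Φ Γ C) (fillC Φ Γ D)
  fillC Φ Γ (mrst C) = rst (fillC Φ Γ C)
  fillC Φ Γ (msft C) = sft (fillC Φ Γ C)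
  fillC Φ Γ (mbox j C) = plugF (renF closedRen (lookup Φ j)) (fillC Φ Γ C)

  fillV : ∀ {n g f} → Vec (ECtx 0) f → Vec (Val 0) g → MV n g f → Val n
  fillV Φ Γ (mvar x) = var x
  fillV Φ Γ (mlam C) = lam (fillC Φ Γ C)
  fillV Φ Γ (mhole i) = renV closedRen (lookup Γ i)

-- 𝔽[Φ;Γ]  (the hole □ left open);  𝔽[t;Φ;Γ] = plugF (fillF Φ Γ 𝔽) t
fillF : ∀ {g f} → Vec (ECtx 0) f → Vec (Val 0) g → MF g f → ECtx 0
fillF Φ Γ fhole = hole
fillF Φ Γ (fappL 𝔽 C) = appL (fillF Φ Γ 𝔽) (fillC Φ Γ C)
fillF Φ Γ (fappR V 𝔽) = appR (fillV Φ Γ V) (fillF Φ Γ 𝔽)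
fillF Φ Γ (frst 𝔽) = rst (fillF Φ Γ 𝔽)
fillF Φ Γ (fbox j 𝔽) = composeF (lookup Φ j) (fillF Φ Γ 𝔽)

data PTm : Set where
  pval : Val 0 → PTm
  prst : Tm 0 → PTm

toTm : PTm → Tm 0
toTm (pval v) = val v
toTm (prst t) = rst t

data State : Set where
  pst : ∀ {g f} → Vec (ECtx 0) f → Vec (Val 0) g → PTm → State
  est : ∀ {g f} → Vec (ECtx 0) f → Vec (Val 0) g → State

-- labels; the sizes g, f of the environment are carried implicitly
data Label : Set where
  τ      : Label
  lamL   : ∀ {g f} → Fin g → MV 0 g f → MF g f → Label
  down   : Label
  boxL   : ∀ {g f} → Fin f → MV 0 g f → MF g f → Label
  pureL  : ∀ {f} → Fin f → Label
  splitL : ∀ {f} → Fin f → Label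

data Step : State → Label → State → Set where
  tauS   : ∀ {g f} {Φ : Vec (ECtx 0) f} {Γ : Vec (Val 0) g} {p p' : PTm} →
           toTm p ⟶ toTm p' → Step (pst Φ Γ p) τ (pst Φ Γ p')
  lamS   : ∀ {g f} {Φ : Vec (ECtx 0) f} {Γ : Vec (Val 0) g}
           (i : Fin g) (V : MV 0 g f) (𝔽 : MF g f) {t : Tm 1} {F' : ECtx 0} →
           lookup Γ i ≡ lam t → fillF Φ Γ 𝔽 ≡ rst F' →
           Step (est Φ Γ) (lamL i V 𝔽) (pst Φ Γ (prst (plugF F' (t [ fillV Φ Γ V ]))))
  downS  : ∀ {g f} {Φ : Vec (ECtx 0) f} {Γ : Vec (Val 0) g} {v : Val 0} →
           Step (pst Φ Γ (pval v)) down (est Φ (Γ ∷ʳ v))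
  boxS   : ∀ {g f} {Φ : Vec (ECtx 0) f} {Γ : Vec (Val 0) g}
           (j : Fin f) (V : MV 0 g f) (𝔽 : MF g f) {F' : ECtx 0} →
           fillF Φ Γ 𝔽 ≡ rst F' →
           Step (est Φ Γ) (boxL j V 𝔽)
                (pst Φ Γ (prst (plugF F' (plugF (lookup Φ j) (val (fillV Φ Γ V))))))
  pureS  : ∀ {g f} {Φ : Vec (ECtx 0) f} {Γ : Vec (Val 0) g} (j : Fin f) {E : PCtx 0} →
           lookup Φ j ≡ embE E → Step (est Φ Γ) (pureL j) (est Φ Γ)
  splitS : ∀ {g f} {Φ : Vec (ECtx 0) f} {Γ : Vec (Val 0) g} (j : Fin f)
           {F : ECtx 0} {E : PCtx 0} →
           lookup Φ j ≡ composeF F (rst (embE E)) →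
           Step (est Φ Γ) (splitL j)
                (est ((Φ ∷ʳ composeF F (rst hole)) ∷ʳ rst (embE E)) Γ)

τStep : State → State → Set
τStep s s' = Step s τ s'

Weak : Label → State → State → Set
Weak τ s s' = Star τStep s s'
Weak α s s' = Σ State λ s₁ → Σ State λ s₂ →
              Star τStep s s₁ × Step s₁ α s₂ × Star τStep s₂ s'

IsBisim : (State → State → Set) → Set
IsBisim R =
  (∀ {s s' s₁ α} → R s s' → Step s α s₁ →
     Σ State λ s₁' → Weak α s' s₁' × R s₁ s₁') ×
  (∀ {s s' s₁' α} → R s s' → Step s' α s₁' →
     Σ State λ s₁ → Weak α s s₁ × R s₁ s₁')

-- ≈ᵖ_env on states: the largest pure environmental bisimulation
_≈ₛ_ : State → State → Set₁
s ≈ₛ s' = Σ (State → State → Set) λ R → IsBisim R × R s s'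

_≈ₜ_ : Tm 0 → Tm 0 → Set₁
t₀ ≈ₜ t₁ = ∀ (E : PCtx 0) →
  pst [] [] (prst (plugE E t₀)) ≈ₛ pst [] [] (prst (plugE E t₁))

Ω : ∀ {n} → Tm n
Ω = app (val (lam δ)) (val (lam δ))
  where δ = app (val (var zero)) (val (var zero))

-- ⟨E[Ω]⟩ only ever reduces to itself, and ⟨E[Sk.Ω]⟩ captures E and reduces to
-- ⟨Ω⟩; by unique decomposition into an evaluation context and a redex these are
-- the only reductions.  Hence both pure states diverge silently: they have τ-steps
-- only, never reach a value (so ↓ never fires), and are not environment states
-- (so no other label fires).  Any relation between silently divergent states is
-- then a bisimulation.
module Submission where

open import Data.Nat using (ℕ; suc)
open import Data.Vec using (Vec)
open import Data.Product using (Σ; _×_; _,_)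
open import Data.Sum using (_⊎_; inj₁; inj₂)
open import Data.Empty using (⊥-elim)
open import Relation.Binary.PropositionalEquality using (_≡_; _≢_; refl; sym; cong; cong₂)
open import Relation.Binary.Construct.Closure.ReflexiveTransitive using (ε)

open import Defs

data Redex {n : ℕ} : Tm n → Set where
  β-redex     : ∀ v w → Redex (app (val v) (val w))
  reset-redex : ∀ v → Redex (rst (val v))
  shift-redex : ∀ E t → Redex (rst (plugE E (sft t)))

app-injˡ : ∀ {n} {a b c d : Tm n} → app a b ≡ app c d → a ≡ c
app-injˡ refl = refl

app-injʳ : ∀ {n} {a b c d : Tm n} → app a b ≡ app c d → b ≡ d
app-injʳ refl = refl

rst-injective : ∀ {n} {a b : Tm n} → rst a ≡ rst b → a ≡ b
rst-injective refl = refl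

sft-injective : ∀ {n} {a b : Tm (suc n)} → sft a ≡ sft b → a ≡ b
sft-injective refl = refl

val-injective : ∀ {n} {a b : Val n} → val a ≡ val b → a ≡ b
val-injective refl = refl

plugE≡plugF-embE : ∀ {n} (E : PCtx n) (t : Tm n) → plugE E t ≡ plugF (embE E) t
plugE≡plugF-embE hole t = refl
plugE≡plugF-embE (appR v E) t = cong (app (val v)) (plugE≡plugF-embE E t)
plugE≡plugF-embE (appL E u) t = cong (λ x → app x u) (plugE≡plugF-embE E t)

plugF-redex≢val : ∀ {n} {a : Tm n} {w} (F : ECtx n) → Redex a → plugF F a ≢ val w
plugF-redex≢val hole (β-redex v w) ()
plugF-redex≢val hole (reset-redex v) ()
plugF-redex≢val hole (shift-redex E t) ()
plugF-redex≢val (appR v F) r ()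
plugF-redex≢val (appL F u) r ()
plugF-redex≢val (rst F) r ()

plugE-sft≢val : ∀ {n} {s : Tm (suc n)} {w} (E : PCtx n) → plugE E (sft s) ≢ val w
plugE-sft≢val hole ()
plugE-sft≢val (appR v E) ()
plugE-sft≢val (appL E u) ()

plugF-redex≢plugE-sft : ∀ {n} {a : Tm n} {s} (F : ECtx n) (E : PCtx n) →
                        Redex a → plugF F a ≢ plugE E (sft s)
plugF-redex≢plugE-sft hole hole (β-redex v w) ()
plugF-redex≢plugE-sft hole hole (reset-redex v) ()
plugF-redex≢plugE-sft hole hole (shift-redex E t) ()
plugF-redex≢plugE-sft hole (appR v E) (β-redex v' w) p = plugE-sft≢val E (sym (app-injʳ p))
plugF-redex≢plugE-sft hole (appL E u) (β-redex v w) p = plugE-sft≢val E (sym (app-injˡ p))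
plugF-redex≢plugE-sft (appR v F) (appR v' E) r p = plugF-redex≢plugE-sft F E r (app-injʳ p)
plugF-redex≢plugE-sft (appR v F) (appL E u) r p = plugE-sft≢val E (sym (app-injˡ p))
plugF-redex≢plugE-sft (appL F u) (appR v E) r p = plugF-redex≢val F r (app-injˡ p)
plugF-redex≢plugE-sft (appL F u) (appL E u') r p = plugF-redex≢plugE-sft F E r (app-injˡ p)

redex≡plugF-redex⇒hole : ∀ {n} {a b : Tm n} (F : ECtx n) →
                         Redex a → Redex b → a ≡ plugF F b → F ≡ hole
redex≡plugF-redex⇒hole hole ra rb p = refl
redex≡plugF-redex⇒hole (appR v F) (β-redex v' w) rb p = ⊥-elim (plugF-redex≢val F rb (sym (app-injʳ p)))
redex≡plugF-redex⇒hole (appL F u) (β-redex v w) rb p = ⊥-elim (plugF-redex≢val F rb (sym (app-injˡ p)))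
redex≡plugF-redex⇒hole (rst F) (reset-redex v) rb p = ⊥-elim (plugF-redex≢val F rb (sym (rst-injective p)))
redex≡plugF-redex⇒hole (rst F) (shift-redex E t) rb p =
  ⊥-elim (plugF-redex≢plugE-sft F E rb (sym (rst-injective p)))

unique-decomposition : ∀ {n} {a b : Tm n} (F F' : ECtx n) → Redex a → Redex b →
                       plugF F a ≡ plugF F' b → F ≡ F' × a ≡ b
unique-decomposition hole F' ra rb p with redex≡plugF-redex⇒hole F' ra rb p
... | refl = refl , p
unique-decomposition F hole ra rb p with redex≡plugF-redex⇒hole F rb ra (sym p)
... | refl = refl , p
unique-decomposition (appR v F) (appR v' F') ra rb p
  with unique-decomposition F F' ra rb (app-injʳ p)
... | F≡F' , a≡b = cong₂ appR (val-injective (app-injˡ p)) F≡F' , a≡b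
unique-decomposition (appR v F) (appL F' u) ra rb p = ⊥-elim (plugF-redex≢val F' rb (sym (app-injˡ p)))
unique-decomposition (appL F u) (appR v F') ra rb p = ⊥-elim (plugF-redex≢val F ra (app-injˡ p))
unique-decomposition (appL F u) (appL F' u') ra rb p
  with unique-decomposition F F' ra rb (app-injˡ p)
... | F≡F' , a≡b = cong₂ appL F≡F' (app-injʳ p) , a≡b
unique-decomposition (rst F) (rst F') ra rb p
  with unique-decomposition F F' ra rb (rst-injective p)
... | F≡F' , a≡b = cong rst F≡F' , a≡b

plugE-sft-injective : ∀ {n} {s s' : Tm (suc n)} (E E' : PCtx n) →
                      plugE E (sft s) ≡ plugE E' (sft s') → s ≡ s'
plugE-sft-injective hole hole p = sft-injective p
plugE-sft-injective (appR v E) (appR v' E') p = plugE-sft-injective E E' (app-injʳ p)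
plugE-sft-injective (appR v E) (appL E' u) p = ⊥-elim (plugE-sft≢val E' (sym (app-injˡ p)))
plugE-sft-injective (appL E u) (appR v E') p = ⊥-elim (plugE-sft≢val E (app-injˡ p))
plugE-sft-injective (appL E u) (appL E' u') p = plugE-sft-injective E E' (app-injˡ p)

ΩInContext : Tm 0 → Set
ΩInContext t = Σ (ECtx 0) λ F → t ≡ plugF F Ω

ShiftΩInReset : Tm 0 → Set
ShiftΩInReset t = Σ (PCtx 0) λ E → t ≡ rst (plugE E (sft Ω))

ΩInContext-⟶ : ∀ {t t'} → t ⟶ t' → ΩInContext t → ΩInContext t'
ΩInContext-⟶ (βv F t v) (G , e) with unique-decomposition F G (β-redex _ _) (β-redex _ _) e
... | refl , refl = G , refl
ΩInContext-⟶ (shift F E t) (G , e) with unique-decomposition F G (shift-redex E t) (β-redex _ _) e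
... | _ , ()
ΩInContext-⟶ (reset F v) (G , e) with unique-decomposition F G (reset-redex v) (β-redex _ _) e
... | _ , ()

-- The captured continuation is discarded because Ω is closed: Ω [ k ] is Ω.
ShiftΩInReset-⟶ : ∀ {t t'} → t ⟶ t' → ShiftΩInReset t → ΩInContext t'
ShiftΩInReset-⟶ (βv F t v) (E , e)
  with unique-decomposition F hole (β-redex _ _) (shift-redex E Ω) e
... | _ , ()
ShiftΩInReset-⟶ (shift F E' t) (E , e)
  with unique-decomposition F hole (shift-redex E' t) (shift-redex E Ω) e
... | refl , redexes with plugE-sft-injective E' E (rst-injective redexes)
...   | refl = rst hole , refl
ShiftΩInReset-⟶ (reset F v) (E , e)
  with unique-decomposition F hole (reset-redex v) (shift-redex E Ω) e
... | _ , redexes = ⊥-elim (plugE-sft≢val E (sym (rst-injective redexes)))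

Silent : (State → Set) → Set
Silent P = ∀ {s α s₁} → P s → Step s α s₁ → α ≡ τ × P s₁

silent⇒bisimilar : ∀ {P} → Silent P → ∀ {s s'} → P s → P s' → s ≈ₛ s'
silent⇒bisimilar {P} silent Ps Ps' = (λ s s' → P s × P s') , (forth , back) , (Ps , Ps')
  where
  forth : ∀ {s s' s₁ α} → P s × P s' → Step s α s₁ →
          Σ State λ s₁' → Weak α s' s₁' × (P s₁ × P s₁')
  forth {s' = s'} (Ps , Ps') step with silent Ps step
  ... | refl , Ps₁ = s' , ε , (Ps₁ , Ps')

  back : ∀ {s s' s₁' α} → P s × P s' → Step s' α s₁' →
         Σ State λ s₁ → Weak α s s₁ × (P s₁ × P s₁')
  back {s = s} (Ps , Ps') step with silent Ps' step
  ... | refl , Ps₁' = s , ε , (Ps , Ps₁')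

data Diverging : State → Set where
  diverging : ∀ {g f} {Φ : Vec (ECtx 0) f} {Γ : Vec (Val 0) g} {p} →
              ΩInContext (toTm p) ⊎ ShiftΩInReset (toTm p) → Diverging (pst Φ Γ p)

diverging-silent : Silent Diverging
diverging-silent (diverging (inj₁ d)) (tauS step) = refl , diverging (inj₁ (ΩInContext-⟶ step d))
diverging-silent (diverging (inj₂ d)) (tauS step) = refl , diverging (inj₁ (ShiftΩInReset-⟶ step d))
diverging-silent (diverging (inj₁ (F , e))) downS = ⊥-elim (plugF-redex≢val F (β-redex _ _) (sym e))

proposition5p10 : Ω ≈ₜ sft Ω
proposition5p10 E =
  silent⇒bisimilar diverging-silent
    (diverging (inj₁ (rst (embE E) , cong rst (plugE≡plugF-embE E Ω))))
    (diverging (inj₂ (E , refl)))
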